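{- Let $v_1,v_2\in\mathcal{A}^{2|1}$ with $\omega(v_1,v_2)=1$. Then there is a unique matrix $g\in\mathrm{OSp}(1|2)$ whose first two columns are $v_1$ and $v_2$.
   Context: $\mathcal{A}$ is a super-commutative algebra and $\mathcal{A}^{2|1}$ the free module of vectors $(x,y|\phi)$ with $x,y$ even and $\phi$ odd. The bilinear form $\omega:\mathcal{A}^{2|1}\times\mathcal{A}^{2|1}\to\mathcal{A}$ is $\omega((a,b|\phi),(x,y|\theta))=ay-bx+\phi\theta$. $\mathrm{OSp}(1|2)$ is the group of $2|1\times2|1$ supermatrices $g$ over $\mathcal{A}$ with Berezinian $1$ and $g^{\mathrm{st}}Jg=J$, where $J=\begin{pmatrix}0&1&0\\-1&0&0\\0&0&1\end{pmatrix}$ and $\mathrm{st}$ is the supertranspose. -}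

module Defs where

open import Level using (Level; _⊔_) renaming (suc to lsuc)
open import Algebra.Bundles using (Ring)
open import Data.Fin using (Fin; zero; suc)
open import Data.Product using (Σ; _×_; _,_)

-- As for super-commutative algebras over ℝ or ℂ (the setting of the paper),
-- 2 is assumed invertible.
record SuperCommAlgebra (c ℓ : Level) : Set (lsuc (c ⊔ ℓ)) where
  field
    ring : Ring c ℓ
  open Ring ring public
  field
    IsEven IsOdd : Carrier → Set ℓ
    even-resp : ∀ {a b} → a ≈ b → IsEven a → IsEven b
    odd-resp  : ∀ {a b} → a ≈ b → IsOdd a → IsOdd b
    even-0 : IsEven 0#
    odd-0  : IsOdd 0#
    even-1 : IsEven 1#
    even-+ : ∀ {a b} → IsEven a → IsEven b → IsEven (a + b)
    odd-+  : ∀ {a b} → IsOdd a → IsOdd b → IsOdd (a + b)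
    even-- : ∀ {a} → IsEven a → IsEven (- a)
    odd--  : ∀ {a} → IsOdd a → IsOdd (- a)
    even-*-even : ∀ {a b} → IsEven a → IsEven b → IsEven (a * b)
    even-*-odd  : ∀ {a b} → IsEven a → IsOdd b → IsOdd (a * b)
    odd-*-even  : ∀ {a b} → IsOdd a → IsEven b → IsOdd (a * b)
    odd-*-odd   : ∀ {a b} → IsOdd a → IsOdd b → IsEven (a * b)
    decompose : ∀ a → Σ Carrier λ e → Σ Carrier λ o → IsEven e × IsOdd o × (a ≈ e + o)
    even∩odd  : ∀ {a} → IsEven a → IsOdd a → a ≈ 0#
    even-comm : ∀ {a} b → IsEven a → a * b ≈ b * a
    odd-anti  : ∀ {a b} → IsOdd a → IsOdd b → a * b ≈ - (b * a)
    half : Carrier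
    two-half : (1# + 1#) * half ≈ 1#

module _ {c ℓ : Level} (S : SuperCommAlgebra c ℓ) where
  open SuperCommAlgebra S using (Carrier; _≈_; _+_; _*_; -_; _-_; 0#; 1#; IsEven; IsOdd)

  record SVec : Set c where
    constructor ⟨_,_∣_⟩
    field
      vx vy vφ : Carrier
  open SVec public

  IsSVec : SVec → Set ℓ
  IsSVec v = IsEven (vx v) × IsEven (vy v) × IsOdd (vφ v)

  _≐_ : SVec → SVec → Set ℓ
  v ≐ w = (vx v ≈ vx w) × (vy v ≈ vy w) × (vφ v ≈ vφ w)

  ω : SVec → SVec → Carrier
  ω ⟨ a , b ∣ φ ⟩ ⟨ x , y ∣ θ ⟩ = a * y - b * x + φ * θ

  -- 2|1 × 2|1 matrices, indices 0,1 even and 2 odd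
  Mat : Set c
  Mat = Fin 3 → Fin 3 → Carrier

  _≋_ : Mat → Mat → Set ℓ
  g ≋ h = ∀ i j → g i j ≈ h i j

  _⊗_ : Mat → Mat → Mat
  (g ⊗ h) i j = g i zero * h zero j + g i (suc zero) * h (suc zero) j
                + g i (suc (suc zero)) * h (suc (suc zero)) j

  parity : Fin 3 → Fin 3 → Carrier → Set ℓ
  parity zero zero = IsEven
  parity zero (suc zero) = IsEven
  parity (suc zero) zero = IsEven
  parity (suc zero) (suc zero) = IsEven
  parity (suc (suc zero)) (suc (suc zero)) = IsEven
  parity zero (suc (suc zero)) = IsOdd
  parity (suc zero) (suc (suc zero)) = IsOdd
  parity (suc (suc zero)) zero = IsOdd
  parity (suc (suc zero)) (suc zero) = IsOdd

  IsSuperMatrix : Mat → Set ℓ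
  IsSuperMatrix g = ∀ i j → parity i j (g i j)

  -- supertranspose of [[A,B],[C,D]] is [[Aᵗ, Cᵗ], [−Bᵗ, Dᵗ]]
  st : Mat → Mat
  st g zero j = g j zero
  st g (suc zero) j = g j (suc zero)
  st g (suc (suc zero)) zero = - g zero (suc (suc zero))
  st g (suc (suc zero)) (suc zero) = - g (suc zero) (suc (suc zero))
  st g (suc (suc zero)) (suc (suc zero)) = g (suc (suc zero)) (suc (suc zero))

  J : Mat
  J zero (suc zero) = 1#
  J (suc zero) zero = - 1#
  J (suc (suc zero)) (suc (suc zero)) = 1#
  J _ _ = 0#

  -- Berezinian of g = [[A,B],[C,D]] (D the 1×1 even block, invertible):
  -- Ber g = det(A − B D⁻¹ C) · D⁻¹.  "Ber g = 1" unfolds to: D has an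
  -- inverse d' and det(A − B d' C) = D.
  -- the even 1×1 block D of g
  blockD : Mat → Carrier
  blockD g = g (suc (suc zero)) (suc (suc zero))

  schur : Mat → Carrier → Fin 3 → Fin 3 → Carrier
  schur g d' i j = g i j - g i (suc (suc zero)) * d' * g (suc (suc zero)) j

  -- determinant of the (even, hence commuting) 2×2 block
  det2 : (Fin 3 → Fin 3 → Carrier) → Carrier
  det2 M = M zero zero * M (suc zero) (suc zero) - M zero (suc zero) * M (suc zero) zero

  BerOne : Mat → Set (c ⊔ ℓ)
  BerOne g = Σ Carrier λ d' → (blockD g * d' ≈ 1#) × (d' * blockD g ≈ 1#)
               × (det2 (schur g d') ≈ blockD g)

  IsOSp : Mat → Set (c ⊔ ℓ)
  IsOSp g = IsSuperMatrix g × BerOne g × ((st g ⊗ (J ⊗ g)) ≋ J)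

  column : Fin 3 → Mat → SVec
  column j g = ⟨ g zero j , g (suc zero) j ∣ g (suc (suc zero)) j ⟩

module Submission where

open import Defs
open import Level using (Level)
open import Data.Fin using (zero; suc)
open import Data.Product using (Σ; _×_; _,_; proj₁; proj₂)
open import Data.Vec using ([]; _∷_)
import Algebra.Properties.Ring as RingProperties
import Algebra.Solver.CommutativeMonoid as CommutativeMonoidSolver
import Relation.Binary.Reasoning.Setoid as SetoidReasoning

-- Write v₁ = (a, c | α), v₂ = (b, d | β) and n = αβ, so that ω(v₁, v₂) = 1 says det A = 1 − n for
-- A = [[a, b], [c, d]]. The condition gᵗˢ J g = J says exactly that the columns of g pair under ω like
-- the standard basis, the last row of gᵗˢ being the third column with its odd entries negated. For a
-- third column (p, q | k) with k even, orthogonality to v₁ and v₂ is a 2×2 linear system with matrix A,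
-- solved by Cramer's rule: (p, q) det A = k (u, w) with u = aβ − bα, w = cβ − dα. As det A is a unit
-- and n² = 0, this gives (p, q) = k (u, w); the Schur complement of k is then A (1 + n), whose
-- determinant is 1 + n, so Ber g = 1 forces k = 1 + n. Conversely (u, w | 1 + n) does satisfy all
-- the conditions.

module _ {r ℓ : Level} (S : SuperCommAlgebra r ℓ) where
  open SuperCommAlgebra S hiding (zero)
  open RingProperties ring
  open SetoidReasoning setoid

  x-0#≈x : ∀ x → x - 0# ≈ x
  x-0#≈x x = trans (+-congˡ -0#≈0#) (+-identityʳ x)

  [x-y]-[z-t]≈[x-z]-[y-t] : ∀ x y z t → (x - y) - (z - t) ≈ (x - z) - (y - t)
  [x-y]-[z-t]≈[x-z]-[y-t] x y z t = begin
    (x - y) - (z - t)         ≈⟨ +-congˡ (⁻¹-anti-homo‿- z t) ⟩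
    (x - y) + (t - z)         ≈⟨ prove 4 ((x′ ⊕ y′) ⊕ (t′ ⊕ z′)) ((x′ ⊕ z′) ⊕ (t′ ⊕ y′))
                                        (x ∷ - y ∷ - z ∷ t ∷ []) ⟩
    (x - z) + (t - y)         ≈⟨ +-congˡ (⁻¹-anti-homo‿- y t) ⟨
    (x - z) - (y - t)         ∎
    where
    open CommutativeMonoidSolver +-commutativeMonoid
    x′ = var zero
    y′ = var (suc zero)
    z′ = var (suc (suc zero))
    t′ = var (suc (suc (suc zero)))

  x+x≈0#⇒x≈0# : ∀ {x} → x + x ≈ 0# → x ≈ 0#
  x+x≈0#⇒x≈0# {x} x+x≈0 = begin
    x                         ≈⟨ *-identityˡ x ⟨
    1# * x                    ≈⟨ *-congʳ two-half ⟨
    ((1# + 1#) * half) * x    ≈⟨ *-congʳ (even-comm half (even-+ even-1 even-1)) ⟩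
    (half * (1# + 1#)) * x    ≈⟨ *-assoc half (1# + 1#) x ⟩
    half * ((1# + 1#) * x)    ≈⟨ *-congˡ (distribʳ x 1# 1#) ⟩
    half * (1# * x + 1# * x)  ≈⟨ *-congˡ (+-cong (*-identityˡ x) (*-identityˡ x)) ⟩
    half * (x + x)            ≈⟨ *-congˡ x+x≈0 ⟩
    half * 0#                 ≈⟨ zeroʳ half ⟩
    0#                        ∎

  odd⇒x*x≈0# : ∀ {x} → IsOdd x → x * x ≈ 0#
  odd⇒x*x≈0# {x} ox = x+x≈0#⇒x≈0# (trans (+-congˡ (odd-anti ox ox)) (-‿inverseʳ (x * x)))

  even-*-swap : ∀ {a} x y → IsEven a → a * (x * y) ≈ x * (a * y)
  even-*-swap {a} x y ea = begin
    a * (x * y)  ≈⟨ *-assoc a x y ⟨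
    (a * x) * y  ≈⟨ *-congʳ (even-comm x ea) ⟩
    (x * a) * y  ≈⟨ *-assoc x a y ⟩
    x * (a * y)  ∎

  even-*-interchange : ∀ p {q} θ φ → IsEven q → (p * θ) * (q * φ) ≈ (p * q) * (θ * φ)
  even-*-interchange p {q} θ φ eq = begin
    (p * θ) * (q * φ)  ≈⟨ *-assoc p θ (q * φ) ⟩
    p * (θ * (q * φ))  ≈⟨ *-congˡ (even-*-swap θ φ eq) ⟨
    p * (q * (θ * φ))  ≈⟨ *-assoc p q (θ * φ) ⟨
    (p * q) * (θ * φ)  ∎

  central-inverse-central : ∀ {k m} → (∀ x → k * x ≈ x * k) → k * m ≈ 1# → m * k ≈ 1# →
                            ∀ x → m * x ≈ x * m
  central-inverse-central {k} {m} k-central km≈1 mk≈1 x = begin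
    m * x              ≈⟨ *-congˡ (*-identityʳ x) ⟨
    m * (x * 1#)       ≈⟨ *-congˡ (*-congˡ km≈1) ⟨
    m * (x * (k * m))  ≈⟨ *-congˡ (*-assoc x k m) ⟨
    m * ((x * k) * m)  ≈⟨ *-congˡ (*-congʳ (k-central x)) ⟨
    m * ((k * x) * m)  ≈⟨ *-assoc m (k * x) m ⟨
    (m * (k * x)) * m  ≈⟨ *-congʳ (*-assoc m k x) ⟨
    ((m * k) * x) * m  ≈⟨ *-congʳ (*-congʳ mk≈1) ⟩
    (1# * x) * m       ≈⟨ *-congʳ (*-identityˡ x) ⟩
    x * m              ∎

  IsOddSVec : SVec S → Set ℓ
  IsOddSVec ⟨ x , y ∣ θ ⟩ = IsOdd x × IsOdd y × IsEven θ

  -- negXY (column 2 g) is the last row of st g.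
  negXY : SVec S → SVec S
  negXY ⟨ x , y ∣ θ ⟩ = ⟨ - x , - y ∣ θ ⟩

  ω-congˡ : ∀ {v v′} w → _≐_ S v v′ → ω S v w ≈ ω S v′ w
  ω-congˡ {⟨ _ , _ ∣ _ ⟩} {⟨ _ , _ ∣ _ ⟩} ⟨ _ , _ ∣ _ ⟩ (x≈x′ , y≈y′ , θ≈θ′) =
    +-cong (+-cong (*-congʳ x≈x′) (-‿cong (*-congʳ y≈y′))) (*-congʳ θ≈θ′)

  ω-alternating : ∀ {v} → IsSVec S v → ω S v v ≈ 0#
  ω-alternating {⟨ x , y ∣ θ ⟩} (ex , ey , oθ) = begin
    x * y - y * x + θ * θ  ≈⟨ +-cong (+-congˡ (-‿cong (even-comm x ey))) (odd⇒x*x≈0# oθ) ⟩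
    x * y - x * y + 0#     ≈⟨ +-identityʳ _ ⟩
    x * y - x * y          ≈⟨ -‿inverseʳ (x * y) ⟩
    0#                     ∎

  ω-antisym : ∀ {v w} → IsSVec S v → IsSVec S w → ω S w v ≈ - ω S v w
  ω-antisym {⟨ x , y ∣ θ ⟩} {⟨ x′ , y′ ∣ θ′ ⟩} (ex , ey , oθ) (ex′ , ey′ , oθ′) = begin
    x′ * y - y′ * x + θ′ * θ
      ≈⟨ +-cong (+-cong (even-comm y ex′) (-‿cong (even-comm x ey′))) (odd-anti oθ′ oθ) ⟩
    (y * x′ - x * y′) + - (θ * θ′)    ≈⟨ +-congʳ (⁻¹-anti-homo‿- (x * y′) (y * x′)) ⟨
    - (x * y′ - y * x′) + - (θ * θ′)  ≈⟨ -‿+-comm _ _ ⟩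
    - (x * y′ - y * x′ + θ * θ′)      ∎

  ω-negXY : ∀ {v w} → IsSVec S v → IsOddSVec w → ω S (negXY w) v ≈ ω S v w
  ω-negXY {⟨ x , y ∣ θ ⟩} {⟨ p , q ∣ k ⟩} (ex , ey , oθ) (op , oq , ek) = begin
    - p * y - - q * x + k * θ
      ≈⟨ +-cong (+-cong (-‿distribˡ-* p y) (-‿cong (-‿distribˡ-* q x))) (sym (even-comm θ ek)) ⟨
    - (p * y) - - (q * x) + θ * k
      ≈⟨ +-congʳ (+-cong (-‿cong (even-comm p ey)) (sym (-‿involutive (q * x)))) ⟨
    - (y * p) + q * x + θ * k         ≈⟨ +-congʳ (+-comm _ _) ⟩
    q * x - y * p + θ * k             ≈⟨ +-congʳ (+-congʳ (even-comm q ex)) ⟨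
    x * q - y * p + θ * k             ∎

  st⊗J⊗≈ω : ∀ g i j → _⊗_ S (st S g) (_⊗_ S (J S) g) i j ≈
            ω S ⟨ st S g i zero , st S g i (suc zero) ∣ st S g i (suc (suc zero)) ⟩ (column S j g)
  st⊗J⊗≈ω g i j = +-cong
    (+-cong (*-congˡ (J-row₀ _ _ _)) (trans (*-congˡ (J-row₁ _ _ _)) (sym (-‿distribʳ-* _ _))))
    (*-congˡ (J-row₂ _ _ _))
    where
    J-row₀ : ∀ x y z → 0# * x + 1# * y + 0# * z ≈ y
    J-row₀ x y z = trans (+-cong (+-cong (zeroˡ x) (*-identityˡ y)) (zeroˡ z))
                         (trans (+-identityʳ _) (+-identityˡ y))
    J-row₁ : ∀ x y z → - 1# * x + 0# * y + 0# * z ≈ - x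
    J-row₁ x y z = trans (+-cong (+-cong (-1*x≈-x x) (zeroˡ y)) (zeroˡ z))
                         (trans (+-identityʳ _) (+-identityʳ (- x)))
    J-row₂ : ∀ x y z → 0# * x + 0# * y + 1# * z ≈ z
    J-row₂ x y z = trans (+-cong (+-cong (zeroˡ x) (zeroˡ y)) (*-identityˡ z))
                         (trans (+-congʳ (+-identityʳ 0#)) (+-identityˡ z))

  ω≈0#⇒k*θ≈p*y-q*x : ∀ {x y θ p q k} → IsEven x → IsEven y → IsEven k →
                      ω S ⟨ x , y ∣ θ ⟩ ⟨ p , q ∣ k ⟩ ≈ 0# → k * θ ≈ p * y - q * x
  ω≈0#⇒k*θ≈p*y-q*x {x} {y} {θ} {p} {q} {k} ex ey ek ω≈0 = begin
    k * θ                  ≈⟨ even-comm θ ek ⟩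
    θ * k                  ≈⟨ +-inverseʳ-unique (x * q - y * p) (θ * k) ω≈0 ⟩
    - (x * q - y * p)      ≈⟨ ⁻¹-anti-homo‿- (x * q) (y * p) ⟩
    y * p - x * q          ≈⟨ +-cong (even-comm p ey) (-‿cong (even-comm q ex)) ⟩
    p * y - q * x          ∎

  k[xβ-yα]≈p[xd-yc]+q[ya-xb] : ∀ {a b c d α β p q k} x y → IsEven x → IsEven y → IsEven k →
    k * α ≈ p * c - q * a → k * β ≈ p * d - q * b →
    k * (x * β - y * α) ≈ p * (x * d - y * c) + q * (y * a - x * b)
  k[xβ-yα]≈p[xd-yc]+q[ya-xb] {a} {b} {c} {d} {α} {β} {p} {q} {k} x y ex ey ek kα kβ = begin
    k * (x * β - y * α)                             ≈⟨ x[y-z]≈xy-xz k (x * β) (y * α) ⟩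
    k * (x * β) - k * (y * α)
      ≈⟨ +-cong (even-*-swap x β ek) (-‿cong (even-*-swap y α ek)) ⟩
    x * (k * β) - y * (k * α)                       ≈⟨ +-cong (*-congˡ kβ) (-‿cong (*-congˡ kα)) ⟩
    x * (p * d - q * b) - y * (p * c - q * a)
      ≈⟨ +-cong (x[y-z]≈xy-xz x _ _) (-‿cong (x[y-z]≈xy-xz y _ _)) ⟩
    (x * (p * d) - x * (q * b)) - (y * (p * c) - y * (q * a))
      ≈⟨ +-cong (+-cong (even-*-swap p d ex) (-‿cong (even-*-swap q b ex)))
                (-‿cong (+-cong (even-*-swap p c ey) (-‿cong (even-*-swap q a ey)))) ⟩
    (p * (x * d) - q * (x * b)) - (p * (y * c) - q * (y * a))
      ≈⟨ [x-y]-[z-t]≈[x-z]-[y-t] _ _ _ _ ⟩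
    (p * (x * d) - p * (y * c)) - (q * (x * b) - q * (y * a))
      ≈⟨ +-congˡ (⁻¹-anti-homo‿- _ _) ⟩
    (p * (x * d) - p * (y * c)) + (q * (y * a) - q * (x * b))
      ≈⟨ +-cong (x[y-z]≈xy-xz p _ _) (x[y-z]≈xy-xz q _ _) ⟨
    p * (x * d - y * c) + q * (y * a - x * b)       ∎

  module OddPair {α β : Carrier} (oα : IsOdd α) (oβ : IsOdd β) where

    n : Carrier
    n = α * β

    n-even : IsEven n
    n-even = odd-*-odd oα oβ

    α*n≈0# : α * n ≈ 0#
    α*n≈0# = trans (sym (*-assoc α α β)) (trans (*-congʳ (odd⇒x*x≈0# oα)) (zeroˡ β))

    n*β≈0# : n * β ≈ 0#
    n*β≈0# = trans (*-assoc α β β) (trans (*-congˡ (odd⇒x*x≈0# oβ)) (zeroʳ α))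

    β*n≈0# : β * n ≈ 0#
    β*n≈0# = trans (sym (even-comm β n-even)) n*β≈0#

    n*n≈0# : n * n ≈ 0#
    n*n≈0# =
      trans (sym (*-assoc n α β)) (trans (*-congʳ (trans (even-comm α n-even) α*n≈0#)) (zeroˡ β))

    x*n≈0#⇒x*[1+n]≈x : ∀ {x} → x * n ≈ 0# → x * (1# + n) ≈ x
    x*n≈0#⇒x*[1+n]≈x {x} xn≈0 =
      trans (distribˡ x 1# n) (trans (+-cong (*-identityʳ x) xn≈0) (+-identityʳ x))

    x*n≈0#⇒x*[1-n]≈x : ∀ {x} → x * n ≈ 0# → x * (1# - n) ≈ x
    x*n≈0#⇒x*[1-n]≈x {x} xn≈0 =
      trans (x[y-z]≈xy-xz x 1# n) (trans (+-cong (*-identityʳ x) (-‿cong xn≈0)) (x-0#≈x x))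

    [xβ-yα]*n≈0# : ∀ x y → (x * β - y * α) * n ≈ 0#
    [xβ-yα]*n≈0# x y = begin
      (x * β - y * α) * n        ≈⟨ [y-z]x≈yx-zx n (x * β) (y * α) ⟩
      (x * β) * n - (y * α) * n  ≈⟨ +-cong (*-assoc x β n) (-‿cong (*-assoc y α n)) ⟩
      x * (β * n) - y * (α * n)  ≈⟨ +-cong (*-congˡ β*n≈0#) (-‿cong (*-congˡ α*n≈0#)) ⟩
      x * 0# - y * 0#            ≈⟨ +-cong (zeroʳ x) (-‿cong (zeroʳ y)) ⟩
      0# - 0#                    ≈⟨ x-0#≈x 0# ⟩
      0#                         ∎

    x-[xβ-yα]α≈x[1+n] : ∀ x y → x - (x * β - y * α) * α ≈ x * (1# + n)
    x-[xβ-yα]α≈x[1+n] x y = begin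
      x - (x * β - y * α) * α          ≈⟨ +-congˡ (-‿cong ([y-z]x≈yx-zx α (x * β) (y * α))) ⟩
      x - ((x * β) * α - (y * α) * α)  ≈⟨ +-congˡ (-‿cong (+-cong (*-assoc x β α) (-‿cong (*-assoc y α α)))) ⟩
      x - (x * (β * α) - y * (α * α))
        ≈⟨ +-congˡ (-‿cong (+-cong (*-congˡ (odd-anti oβ oα)) (-‿cong (*-congˡ (odd⇒x*x≈0# oα))))) ⟩
      x - (x * - n - y * 0#)           ≈⟨ +-congˡ (-‿cong (+-cong (sym (-‿distribʳ-* x n)) (-‿cong (zeroʳ y)))) ⟩
      x - (- (x * n) - 0#)             ≈⟨ +-congˡ (-‿cong (x-0#≈x _)) ⟩
      x - - (x * n)                    ≈⟨ +-congˡ (-‿involutive (x * n)) ⟩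
      x + x * n                        ≈⟨ +-congʳ (*-identityʳ x) ⟨
      x * 1# + x * n                   ≈⟨ distribˡ x 1# n ⟨
      x * (1# + n)                     ∎

    y-[xβ-yα]β≈y[1+n] : ∀ x y → y - (x * β - y * α) * β ≈ y * (1# + n)
    y-[xβ-yα]β≈y[1+n] x y = begin
      y - (x * β - y * α) * β          ≈⟨ +-congˡ (-‿cong ([y-z]x≈yx-zx β (x * β) (y * α))) ⟩
      y - ((x * β) * β - (y * α) * β)  ≈⟨ +-congˡ (-‿cong (+-cong (*-assoc x β β) (-‿cong (*-assoc y α β)))) ⟩
      y - (x * (β * β) - y * n)        ≈⟨ +-congˡ (-‿cong (+-congʳ (trans (*-congˡ (odd⇒x*x≈0# oβ)) (zeroʳ x)))) ⟩
      y - (0# - y * n)                 ≈⟨ +-congˡ (-‿cong (+-identityˡ _)) ⟩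
      y - - (y * n)                    ≈⟨ +-congˡ (-‿involutive (y * n)) ⟩
      y + y * n                        ≈⟨ +-congʳ (*-identityʳ y) ⟨
      y * 1# + y * n                   ≈⟨ distribˡ y 1# n ⟨
      y * (1# + n)                     ∎

    [1-n]*[1+n]≈1# : (1# - n) * (1# + n) ≈ 1#
    [1-n]*[1+n]≈1# = begin
      (1# - n) * (1# + n)              ≈⟨ [y-z]x≈yx-zx (1# + n) 1# n ⟩
      1# * (1# + n) - n * (1# + n)     ≈⟨ +-cong (*-identityˡ _) (-‿cong (x*n≈0#⇒x*[1+n]≈x n*n≈0#)) ⟩
      (1# + n) - n                     ≈⟨ +-assoc 1# n (- n) ⟩
      1# + (n - n)                     ≈⟨ +-congˡ (-‿inverseʳ n) ⟩
      1# + 0#                          ≈⟨ +-identityʳ 1# ⟩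
      1#                               ∎

    [1+n]*[1-n]≈1# : (1# + n) * (1# - n) ≈ 1#
    [1+n]*[1-n]≈1# = trans (even-comm (1# - n) (even-+ even-1 n-even)) [1-n]*[1+n]≈1#

  module Frame {a b c d α β : Carrier}
    (ea : IsEven a) (eb : IsEven b) (ec : IsEven c) (ed : IsEven d) (oα : IsOdd α) (oβ : IsOdd β)
    (ω[v₁,v₂]≈1# : ω S ⟨ a , c ∣ α ⟩ ⟨ b , d ∣ β ⟩ ≈ 1#) where
    open OddPair oα oβ

    u w : Carrier
    u = a * β - b * α
    w = c * β - d * α

    v₁ v₂ v₃ : SVec S
    v₁ = ⟨ a , c ∣ α ⟩
    v₂ = ⟨ b , d ∣ β ⟩
    v₃ = ⟨ u , w ∣ 1# + n ⟩

    v₁-even : IsSVec S v₁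
    v₁-even = ea , ec , oα

    v₂-even : IsSVec S v₂
    v₂-even = eb , ed , oβ

    v₃-odd : IsOddSVec v₃
    v₃-odd = odd-+ (even-*-odd ea oβ) (odd-- (even-*-odd eb oα))
           , odd-+ (even-*-odd ec oβ) (odd-- (even-*-odd ed oα))
           , even-+ even-1 n-even

    ad-bc≈1-n : a * d - b * c ≈ 1# - n
    ad-bc≈1-n = x≈z//y _ n 1# (trans (+-congʳ (+-congˡ (-‿cong (sym (even-comm b ec))))) ω[v₁,v₂]≈1#)

    -- v₃ = v₁ β − v₂ α + (0, 0 | 1 − n).
    ω-v₃-expansion : ∀ x y θ → ω S ⟨ x , y ∣ θ ⟩ v₃ ≈
      ω S ⟨ x , y ∣ θ ⟩ v₁ * β - ω S ⟨ x , y ∣ θ ⟩ v₂ * α + θ * (1# - n)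
    ω-v₃-expansion x y θ = sym (begin
      (P + θ * α) * β - (Q + θ * β) * α + θ * (1# - n)
        ≈⟨ +-cong (+-cong (distribʳ β P (θ * α)) (-‿cong (distribʳ α Q (θ * β)))) (x[y-z]≈xy-xz θ 1# n) ⟩
      (P * β + (θ * α) * β) - (Q * α + (θ * β) * α) + (θ * 1# - θ * n)
        ≈⟨ +-cong (+-cong (+-congˡ (*-assoc θ α β)) (-‿cong (+-congˡ θβα≈-θn))) (+-congʳ (*-identityʳ θ)) ⟩
      (P * β + θ * n) - (Q * α - θ * n) + (θ - θ * n)
        ≈⟨ +-congʳ (+-congˡ (⁻¹-anti-homo‿- (Q * α) (θ * n))) ⟩
      (P * β + θ * n) + (θ * n - Q * α) + (θ - θ * n)
        ≈⟨ regroup (P * β) (θ * n) (- (Q * α)) θ ⟩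
      (P * β - Q * α) + (θ + θ * n) + (θ * n - θ * n)
        ≈⟨ trans (+-congˡ (-‿inverseʳ (θ * n))) (+-identityʳ _) ⟩
      (P * β - Q * α) + (θ + θ * n)
        ≈⟨ +-cong xw-yu≈Pβ-Qα (trans (distribˡ θ 1# n) (+-congʳ (*-identityʳ θ))) ⟨
      x * w - y * u + θ * (1# + n)   ∎)
      where
      P = x * c - y * a
      Q = x * d - y * b

      θβα≈-θn : (θ * β) * α ≈ - (θ * n)
      θβα≈-θn = trans (*-assoc θ β α) (trans (*-congˡ (odd-anti oβ oα)) (sym (-‿distribʳ-* θ n)))

      regroup : ∀ A B C D → (A + B) + (B + C) + (D - B) ≈ (A + C) + (D + B) + (B - B)
      regroup A B C D = prove 5 (((A′ ⊕ B′) ⊕ (B′ ⊕ C′)) ⊕ (D′ ⊕ B⁻))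
                                (((A′ ⊕ C′) ⊕ (D′ ⊕ B′)) ⊕ (B′ ⊕ B⁻)) (A ∷ B ∷ C ∷ D ∷ - B ∷ [])
        where
        open CommutativeMonoidSolver +-commutativeMonoid
        A′ = var zero
        B′ = var (suc zero)
        C′ = var (suc (suc zero))
        D′ = var (suc (suc (suc zero)))
        B⁻ = var (suc (suc (suc (suc zero))))

      xw-yu≈Pβ-Qα : x * w - y * u ≈ P * β - Q * α
      xw-yu≈Pβ-Qα = begin
        x * w - y * u
          ≈⟨ +-cong (x[y-z]≈xy-xz x (c * β) (d * α)) (-‿cong (x[y-z]≈xy-xz y (a * β) (b * α))) ⟩
        (x * (c * β) - x * (d * α)) - (y * (a * β) - y * (b * α))
          ≈⟨ +-cong (+-cong (*-assoc x c β) (-‿cong (*-assoc x d α)))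
                    (-‿cong (+-cong (*-assoc y a β) (-‿cong (*-assoc y b α)))) ⟨
        ((x * c) * β - (x * d) * α) - ((y * a) * β - (y * b) * α)
          ≈⟨ [x-y]-[z-t]≈[x-z]-[y-t] _ _ _ _ ⟩
        ((x * c) * β - (y * a) * β) - ((x * d) * α - (y * b) * α)
          ≈⟨ +-cong ([y-z]x≈yx-zx β (x * c) (y * a)) (-‿cong ([y-z]x≈yx-zx α (x * d) (y * b))) ⟨
        P * β - Q * α   ∎

    ω[v₁,v₃]≈0# : ω S v₁ v₃ ≈ 0#
    ω[v₁,v₃]≈0# = begin
      ω S v₁ v₃                                     ≈⟨ ω-v₃-expansion a c α ⟩
      ω S v₁ v₁ * β - ω S v₁ v₂ * α + α * (1# - n)
        ≈⟨ +-cong (+-cong (*-congʳ (ω-alternating v₁-even)) (-‿cong (*-congʳ ω[v₁,v₂]≈1#)))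
                  (x*n≈0#⇒x*[1-n]≈x α*n≈0#) ⟩
      0# * β - 1# * α + α                           ≈⟨ +-congʳ (+-cong (zeroˡ β) (-‿cong (*-identityˡ α))) ⟩
      0# - α + α                                    ≈⟨ +-congʳ (+-identityˡ (- α)) ⟩
      - α + α                                       ≈⟨ -‿inverseˡ α ⟩
      0#                                            ∎

    ω[v₂,v₃]≈0# : ω S v₂ v₃ ≈ 0#
    ω[v₂,v₃]≈0# = begin
      ω S v₂ v₃                                     ≈⟨ ω-v₃-expansion b d β ⟩
      ω S v₂ v₁ * β - ω S v₂ v₂ * α + β * (1# - n)
        ≈⟨ +-cong (+-cong (*-congʳ (trans (ω-antisym v₁-even v₂-even) (-‿cong ω[v₁,v₂]≈1#)))
                          (-‿cong (*-congʳ (ω-alternating v₂-even))))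
                  (x*n≈0#⇒x*[1-n]≈x β*n≈0#) ⟩
      - 1# * β - 0# * α + β                         ≈⟨ +-congʳ (+-cong (-1*x≈-x β) (-‿cong (zeroˡ α))) ⟩
      - β - 0# + β                                  ≈⟨ +-congʳ (x-0#≈x (- β)) ⟩
      - β + β                                       ≈⟨ -‿inverseˡ β ⟩
      0#                                            ∎

    ω[negXY-v₃,v₃]≈1# : ω S (negXY v₃) v₃ ≈ 1#
    ω[negXY-v₃,v₃]≈1# = begin
      ω S (negXY v₃) v₃                             ≈⟨ ω-v₃-expansion (- u) (- w) (1# + n) ⟩
      ω S (negXY v₃) v₁ * β - ω S (negXY v₃) v₂ * α + (1# + n) * (1# - n)
        ≈⟨ +-cong (+-cong (*-congʳ (trans (ω-negXY v₁-even v₃-odd) ω[v₁,v₃]≈0#))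
                          (-‿cong (*-congʳ (trans (ω-negXY v₂-even v₃-odd) ω[v₂,v₃]≈0#))))
                  [1+n]*[1-n]≈1# ⟩
      0# * β - 0# * α + 1#                          ≈⟨ +-congʳ (+-cong (zeroˡ β) (-‿cong (zeroˡ α))) ⟩
      0# - 0# + 1#                                  ≈⟨ +-congʳ (x-0#≈x 0#) ⟩
      0# + 1#                                       ≈⟨ +-identityˡ 1# ⟩
      1#                                            ∎

    -- The Schur complement is A (1 + n), of determinant (1 − n) (1 + n)².
    det-schur≈1+n : ∀ h m → _≐_ S (column S zero h) v₁ → _≐_ S (column S (suc zero) h) v₂ →
                    h zero (suc (suc zero)) * m ≈ u → h (suc zero) (suc (suc zero)) * m ≈ w →
                    det2 S (schur S h m) ≈ 1# + n
    det-schur≈1+n h m (h₀₀ , h₁₀ , h₂₀) (h₀₁ , h₁₁ , h₂₁) h₀₂m≈u h₁₂m≈w = begin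
      det2 S (schur S h m)
        ≈⟨ +-cong (*-cong (entry h₀₀ h₀₂m≈u h₂₀) (entry h₁₁ h₁₂m≈w h₂₁))
                  (-‿cong (*-cong (entry h₀₁ h₀₂m≈u h₂₁) (entry h₁₀ h₁₂m≈w h₂₀))) ⟩
      (a - u * α) * (d - w * β) - (b - u * β) * (c - w * α)
        ≈⟨ +-cong (*-cong (x-[xβ-yα]α≈x[1+n] a b) (y-[xβ-yα]β≈y[1+n] c d))
                  (-‿cong (*-cong (y-[xβ-yα]β≈y[1+n] a b) (x-[xβ-yα]α≈x[1+n] c d))) ⟩
      (a * H) * (d * H) - (b * H) * (c * H)
        ≈⟨ +-cong (even-*-interchange a H H ed) (-‿cong (even-*-interchange b H H ec)) ⟩
      (a * d) * (H * H) - (b * c) * (H * H)      ≈⟨ [y-z]x≈yx-zx (H * H) (a * d) (b * c) ⟨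
      (a * d - b * c) * (H * H)                  ≈⟨ *-congʳ ad-bc≈1-n ⟩
      (1# - n) * (H * H)                         ≈⟨ *-assoc (1# - n) H H ⟨
      ((1# - n) * H) * H                         ≈⟨ *-congʳ [1-n]*[1+n]≈1# ⟩
      1# * H                                     ≈⟨ *-identityˡ H ⟩
      H                                          ∎
      where
      H = 1# + n
      entry : ∀ {i j k x p θ} → h i j ≈ x → h i k * m ≈ p → h k j ≈ θ → h i j - h i k * m * h k j ≈ x - p * θ
      entry x≈ p≈ θ≈ = +-cong x≈ (-‿cong (*-cong p≈ θ≈))

    ω-orthogonal⇒k*u≈p*[1-n]×k*w≈q*[1-n] : ∀ {p q k} → IsEven k →
      ω S v₁ ⟨ p , q ∣ k ⟩ ≈ 0# → ω S v₂ ⟨ p , q ∣ k ⟩ ≈ 0# →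
      (k * u ≈ p * (1# - n)) × (k * w ≈ q * (1# - n))
    ω-orthogonal⇒k*u≈p*[1-n]×k*w≈q*[1-n] {p} {q} {k} ek ω[v₁,z]≈0 ω[v₂,z]≈0 = ku≈p[1-n] , kw≈q[1-n]
      where
      kα≈pc-qa : k * α ≈ p * c - q * a
      kα≈pc-qa = ω≈0#⇒k*θ≈p*y-q*x ea ec ek ω[v₁,z]≈0
      kβ≈pd-qb : k * β ≈ p * d - q * b
      kβ≈pd-qb = ω≈0#⇒k*θ≈p*y-q*x eb ed ek ω[v₂,z]≈0

      ku≈p[1-n] : k * u ≈ p * (1# - n)
      ku≈p[1-n] = begin
        k * u                                  ≈⟨ k[xβ-yα]≈p[xd-yc]+q[ya-xb] a b ea eb ek kα≈pc-qa kβ≈pd-qb ⟩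
        p * (a * d - b * c) + q * (b * a - a * b)
          ≈⟨ +-cong (*-congˡ ad-bc≈1-n) (*-congˡ (trans (+-congˡ (-‿cong (even-comm b ea))) (-‿inverseʳ (b * a)))) ⟩
        p * (1# - n) + q * 0#                  ≈⟨ +-congˡ (zeroʳ q) ⟩
        p * (1# - n) + 0#                      ≈⟨ +-identityʳ _ ⟩
        p * (1# - n)                           ∎

      kw≈q[1-n] : k * w ≈ q * (1# - n)
      kw≈q[1-n] = begin
        k * w                                  ≈⟨ k[xβ-yα]≈p[xd-yc]+q[ya-xb] c d ec ed ek kα≈pc-qa kβ≈pd-qb ⟩
        p * (c * d - d * c) + q * (d * a - c * b)
          ≈⟨ +-cong (*-congˡ (trans (+-congˡ (-‿cong (even-comm c ed))) (-‿inverseʳ (c * d))))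
                    (*-congˡ (trans (+-cong (even-comm a ed) (-‿cong (even-comm b ec))) ad-bc≈1-n)) ⟩
        p * 0# + q * (1# - n)                  ≈⟨ +-congʳ (zeroʳ p) ⟩
        0# + q * (1# - n)                      ≈⟨ +-identityˡ _ ⟩
        q * (1# - n)                           ∎

    frame : Mat S
    frame zero zero = a
    frame zero (suc zero) = b
    frame zero (suc (suc zero)) = u
    frame (suc zero) zero = c
    frame (suc zero) (suc zero) = d
    frame (suc zero) (suc (suc zero)) = w
    frame (suc (suc zero)) zero = α
    frame (suc (suc zero)) (suc zero) = β
    frame (suc (suc zero)) (suc (suc zero)) = 1# + n

    frame-isOSp : IsOSp S frame
    frame-isOSp = frame-super , frame-Ber , λ i j → trans (st⊗J⊗≈ω frame i j) (ω-table i j)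
      where
      frame-super : IsSuperMatrix S frame
      frame-super zero zero = ea
      frame-super zero (suc zero) = eb
      frame-super zero (suc (suc zero)) = proj₁ v₃-odd
      frame-super (suc zero) zero = ec
      frame-super (suc zero) (suc zero) = ed
      frame-super (suc zero) (suc (suc zero)) = proj₁ (proj₂ v₃-odd)
      frame-super (suc (suc zero)) zero = oα
      frame-super (suc (suc zero)) (suc zero) = oβ
      frame-super (suc (suc zero)) (suc (suc zero)) = proj₂ (proj₂ v₃-odd)

      frame-Ber : BerOne S frame
      frame-Ber = 1# - n , [1+n]*[1-n]≈1# , [1-n]*[1+n]≈1#
                , det-schur≈1+n frame (1# - n) (refl , refl , refl) (refl , refl , refl)
                    (x*n≈0#⇒x*[1-n]≈x ([xβ-yα]*n≈0# a b)) (x*n≈0#⇒x*[1-n]≈x ([xβ-yα]*n≈0# c d))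

      ω-table : ∀ i j → ω S ⟨ st S frame i zero , st S frame i (suc zero) ∣ st S frame i (suc (suc zero)) ⟩
                             (column S j frame) ≈ J S i j
      ω-table zero zero = ω-alternating v₁-even
      ω-table zero (suc zero) = ω[v₁,v₂]≈1#
      ω-table zero (suc (suc zero)) = ω[v₁,v₃]≈0#
      ω-table (suc zero) zero = trans (ω-antisym v₁-even v₂-even) (-‿cong ω[v₁,v₂]≈1#)
      ω-table (suc zero) (suc zero) = ω-alternating v₂-even
      ω-table (suc zero) (suc (suc zero)) = ω[v₂,v₃]≈0#
      ω-table (suc (suc zero)) zero = trans (ω-negXY v₁-even v₃-odd) ω[v₁,v₃]≈0#
      ω-table (suc (suc zero)) (suc zero) = trans (ω-negXY v₂-even v₃-odd) ω[v₂,v₃]≈0#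
      ω-table (suc (suc zero)) (suc (suc zero)) = ω[negXY-v₃,v₃]≈1#

    frame-unique : ∀ h → IsOSp S h → _≐_ S (column S zero h) v₁ → _≐_ S (column S (suc zero) h) v₂ →
                   _≋_ S h frame
    frame-unique h (h-super , (m , km≈1 , mk≈1 , det≈k) , hJ)
                 col₀≐v₁@(h₀₀ , h₁₀ , h₂₀) col₁≐v₂@(h₀₁ , h₁₁ , h₂₁) = h≋frame
      where
      p = h zero (suc (suc zero))
      q = h (suc zero) (suc (suc zero))
      k = h (suc (suc zero)) (suc (suc zero))
      z = column S (suc (suc zero)) h

      k-even : IsEven k
      k-even = h-super (suc (suc zero)) (suc (suc zero))

      z-odd : IsOddSVec z
      z-odd = h-super zero (suc (suc zero)) , h-super (suc zero) (suc (suc zero)) , k-even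

      ω[v,z]≈J₂ⱼ : ∀ {v} j → IsSVec S (column S j h) → _≐_ S (column S j h) v → ω S v z ≈ J S (suc (suc zero)) j
      ω[v,z]≈J₂ⱼ {v} j colⱼ-even colⱼ≐v = begin
        ω S v z                               ≈⟨ ω-congˡ z colⱼ≐v ⟨
        ω S (column S j h) z                  ≈⟨ ω-negXY colⱼ-even z-odd ⟨
        ω S (negXY z) (column S j h)          ≈⟨ st⊗J⊗≈ω h (suc (suc zero)) j ⟨
        _⊗_ S (st S h) (_⊗_ S (J S) h) (suc (suc zero)) j ≈⟨ hJ (suc (suc zero)) j ⟩
        J S (suc (suc zero)) j                ∎

      ku≈p[1-n]×kw≈q[1-n] : (k * u ≈ p * (1# - n)) × (k * w ≈ q * (1# - n))
      ku≈p[1-n]×kw≈q[1-n] = ω-orthogonal⇒k*u≈p*[1-n]×k*w≈q*[1-n] k-even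
        (ω[v,z]≈J₂ⱼ zero
          (h-super zero zero , h-super (suc zero) zero , h-super (suc (suc zero)) zero) col₀≐v₁)
        (ω[v,z]≈J₂ⱼ (suc zero)
          (h-super zero (suc zero) , h-super (suc zero) (suc zero) , h-super (suc (suc zero)) (suc zero)) col₁≐v₂)

      m-central : ∀ x → m * x ≈ x * m
      m-central = central-inverse-central (λ x → even-comm x k-even) km≈1 mk≈1

      -- m = k⁻¹ commutes with 1 − n, which is invertible with inverse 1 + n.
      solve-*m : ∀ {r t} → k * t ≈ r * (1# - n) → t * (1# + n) ≈ t → r * m ≈ t
      solve-*m {r} {t} kt≈r[1-n] t[1+n]≈t = begin
        r * m                                  ≈⟨ *-identityʳ (r * m) ⟨
        (r * m) * 1#                           ≈⟨ *-congˡ [1-n]*[1+n]≈1# ⟨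
        (r * m) * ((1# - n) * (1# + n))        ≈⟨ *-assoc (r * m) (1# - n) (1# + n) ⟨
        ((r * m) * (1# - n)) * (1# + n)        ≈⟨ *-congʳ rm[1-n]≈t ⟩
        t * (1# + n)                           ≈⟨ t[1+n]≈t ⟩
        t                                      ∎
        where
        rm[1-n]≈t : (r * m) * (1# - n) ≈ t
        rm[1-n]≈t = begin
          (r * m) * (1# - n)                   ≈⟨ *-assoc r m (1# - n) ⟩
          r * (m * (1# - n))                   ≈⟨ *-congˡ (m-central (1# - n)) ⟩
          r * ((1# - n) * m)                   ≈⟨ *-assoc r (1# - n) m ⟨
          (r * (1# - n)) * m                   ≈⟨ *-congʳ kt≈r[1-n] ⟨
          (k * t) * m                          ≈⟨ *-congʳ (even-comm t k-even) ⟩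
          (t * k) * m                          ≈⟨ *-assoc t k m ⟩
          t * (k * m)                          ≈⟨ *-congˡ km≈1 ⟩
          t * 1#                               ≈⟨ *-identityʳ t ⟩
          t                                    ∎

      u[1+n]≈u : u * (1# + n) ≈ u
      u[1+n]≈u = x*n≈0#⇒x*[1+n]≈x ([xβ-yα]*n≈0# a b)

      w[1+n]≈w : w * (1# + n) ≈ w
      w[1+n]≈w = x*n≈0#⇒x*[1+n]≈x ([xβ-yα]*n≈0# c d)

      pm≈u : p * m ≈ u
      pm≈u = solve-*m (proj₁ ku≈p[1-n]×kw≈q[1-n]) u[1+n]≈u

      qm≈w : q * m ≈ w
      qm≈w = solve-*m (proj₂ ku≈p[1-n]×kw≈q[1-n]) w[1+n]≈w

      k≈1+n : k ≈ 1# + n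
      k≈1+n = trans (sym det≈k) (det-schur≈1+n h m col₀≐v₁ col₁≐v₂ pm≈u qm≈w)

      cancel-m : ∀ {r t} → r * m ≈ t → t * (1# + n) ≈ t → r ≈ t
      cancel-m {r} {t} rm≈t t[1+n]≈t = begin
        r                                      ≈⟨ *-identityʳ r ⟨
        r * 1#                                 ≈⟨ *-congˡ mk≈1 ⟨
        r * (m * k)                            ≈⟨ *-assoc r m k ⟨
        (r * m) * k                            ≈⟨ *-cong rm≈t k≈1+n ⟩
        t * (1# + n)                           ≈⟨ t[1+n]≈t ⟩
        t                                      ∎

      h≋frame : _≋_ S h frame
      h≋frame zero zero = h₀₀
      h≋frame zero (suc zero) = h₀₁
      h≋frame zero (suc (suc zero)) = cancel-m pm≈u u[1+n]≈u
      h≋frame (suc zero) zero = h₁₀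
      h≋frame (suc zero) (suc zero) = h₁₁
      h≋frame (suc zero) (suc (suc zero)) = cancel-m qm≈w w[1+n]≈w
      h≋frame (suc (suc zero)) zero = h₂₀
      h≋frame (suc (suc zero)) (suc zero) = h₂₁
      h≋frame (suc (suc zero)) (suc (suc zero)) = k≈1+n

lemma7p6 : {c ℓ : Level} (S : SuperCommAlgebra c ℓ) (v₁ v₂ : SVec S) →
    IsSVec S v₁ → IsSVec S v₂ →
    SuperCommAlgebra._≈_ S (ω S v₁ v₂) (SuperCommAlgebra.1# S) →
    Σ (Mat S) λ g →
      (IsOSp S g × _≐_ S (column S zero g) v₁ × _≐_ S (column S (suc zero) g) v₂)
      × ((h : Mat S) → IsOSp S h → _≐_ S (column S zero h) v₁ →
           _≐_ S (column S (suc zero) h) v₂ → _≋_ S h g)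
lemma7p6 S ⟨ a , c ∣ α ⟩ ⟨ b , d ∣ β ⟩ (ea , ec , oα) (eb , ed , oβ) ω[v₁,v₂]≈1 =
  frame , (frame-isOSp , (refl , refl , refl) , (refl , refl , refl)) , frame-unique
  where
  open SuperCommAlgebra S using (refl)
  open Frame S ea eb ec ed oα oβ ω[v₁,v₂]≈1
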